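{- Let $S$ be a decision rule system and let $S'$ be a nonempty subsystem of $S$ (i.e., $\emptyset\ne S'\subseteq S$). Then $h_{AR}(S)\ge h_{AR}(S')$.
   Context: Let $\omega=\{0,1,2,\dots\}$ and let $\{a_i:i\in\omega\}$ be a set of attributes. A decision rule $r$ is an expression $(a_{i_1}=\delta_1)\wedge\cdots\wedge(a_{i_m}=\delta_m)\to\sigma$ with $m\in\omega$, pairwise different attributes, and $\delta_j,\sigma\in\omega$. Its right-hand side is $\sigma$, $A(r)=\{a_{i_1},\dots,a_{i_m}\}$, and $K(r)=\{a_{i_1}=\delta_1,\dots,a_{i_m}=\delta_m\}$. Two rules are equal iff they have the same $K(\cdot)$ and the same right-hand side. A decision rule system $S$ is a finite nonempty set of decision rules. Let $A(S)=\bigcup_{r\in S}A(r)$ and $n(S)=|A(S)|$. For $a_i\in A(S)$, $V_S(a_i)=\{\delta:(a_i=\delta)\in\bigcup_{r\in S}K(r)\}$. A set of equations $\{a_{i_1}=\delta_1,\dots,a_{i_m}=\delta_m\}$ is inconsistent if there are $l\ne t$ with $i_l=i_t$ and $\delta_l\ne\delta_t$, and consistent otherwise. An o-tree over $S$ is a finite directed rooted tree with working nodes labeled by attributes from $A(S)$ and terminal nodes labeled by subsets of $S$. A working node labeled $a_i$ has exactly $|V_S(a_i)|$ outgoing edges, labeled with pairwise distinct elements of $V_S(a_i)$. For a complete path $\xi$ (root to terminal node), $K(\xi)$ is the set of equations $a_i=\delta$ with $a_i$ labeling a working node of $\xi$ and $\delta$ labeling the edge of $\xi$ leaving it. $\tau(\xi)$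 is the label of the terminal node of $\xi$, and $h(\xi)$ is the number of working nodes of $\xi$. The depth $h(\Gamma)$ is the maximum of $h(\xi)$ over complete paths. An o-tree solves $AR(S)$ if every complete path $\xi$ with $K(\xi)$ consistent satisfies: $K(r)\subseteq K(\xi)$ for all $r\in\tau(\xi)$, and $K(r)\cup K(\xi)$ is inconsistent for all $r\in S\setminus\tau(\xi)$. $h_{AR}(S)$ is the minimum depth of an o-tree over $S$ solving $AR(S)$. If $n(S)=0$, this is $0$. -}

module Defs where

open import Data.Nat using (ℕ; zero; suc; _⊔_; _≤_)
open import Data.Product using (Σ; ∃; _×_; _,_; proj₁; proj₂)
open import Data.List using (List; []; _∷_; map; _++_)
open import Data.List.Membership.Propositional using (_∈_)
open import Data.List.Relation.Unary.Any using (Any)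
open import Data.List.Relation.Unary.All using (All)
open import Data.List.Relation.Unary.Unique.Propositional using (Unique)
open import Relation.Binary.PropositionalEquality using (_≡_; _≢_)
open import Relation.Nullary using (¬_)
open import Function.Bundles using (_⇔_)

-- An equation a_i = δ is the pair (i , δ).
Equation : Set
Equation = ℕ × ℕ

-- A set of equations is given by a list (read as a set: only membership matters).
Inconsistent : List Equation → Set
Inconsistent K = ∃ λ i → ∃ λ δ → ∃ λ δ' → ((i , δ) ∈ K) × ((i , δ') ∈ K) × (δ ≢ δ')

Consistent : List Equation → Set
Consistent K = ¬ Inconsistent K

_⊆E_ : List Equation → List Equation → Set
K ⊆E L = ∀ e → e ∈ K → e ∈ L

-- A decision rule (a_{i1}=δ1) ∧ … ∧ (a_{im}=δm) → σ with pairwise different attributes.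
record Rule : Set where
  constructor mkRule
  field
    conds    : List Equation
    distinct : Unique (map proj₁ conds)
    rhs      : ℕ
open Rule public

_≈R_ : Rule → Rule → Set
r ≈R r' = (∀ e → (e ∈ conds r) ⇔ (e ∈ conds r')) × (rhs r ≡ rhs r')

-- A (finite) set of rules, represented by a list read as a set up to ≈R.
RuleSet : Set
RuleSet = List Rule

_∈S_ : Rule → RuleSet → Set
r ∈S S = Any (λ r' → r ≈R r') S

_⊆S_ : RuleSet → RuleSet → Set
S ⊆S T = ∀ r → r ∈S S → r ∈S T

NonEmpty : RuleSet → Set
NonEmpty S = S ≢ []

_∈A_ : ℕ → RuleSet → Set
i ∈A S = ∃ λ r → (r ∈S S) × ∃ λ δ → (i , δ) ∈ conds r

InV : RuleSet → ℕ → ℕ → Set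
InV S i δ = ∃ λ r → (r ∈S S) × ((i , δ) ∈ conds r)

-- Finite rooted trees: working nodes labelled by an attribute index with
-- edges labelled by values; terminal nodes labelled by sets of rules.
data Tree : Set where
  leaf : RuleSet → Tree
  node : ℕ → List (ℕ × Tree) → Tree

data OTree (S : RuleSet) : Tree → Set where
  leaf-ok : ∀ {τ} → τ ⊆S S → OTree S (leaf τ)
  node-ok : ∀ {i ch} →
            i ∈A S →
            Unique (map proj₁ ch) →
            (∀ δ → (δ ∈ map proj₁ ch) ⇔ InV S i δ) →
            All (λ e → OTree S (proj₂ e)) ch →
            OTree S (node i ch)

-- Γ solves AR(S): checked along every complete path; the second argument
-- accumulates K(ξ) for the path prefix.
data SolvesFrom (S : RuleSet) : List Equation → Tree → Set where
  leaf-s : ∀ {K τ} →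
           (Consistent K →
              (∀ r → r ∈S τ → conds r ⊆E K) ×
              (∀ r → r ∈S S → ¬ (r ∈S τ) → Inconsistent (conds r ++ K))) →
           SolvesFrom S K (leaf τ)
  node-s : ∀ {K i ch} →
           All (λ e → SolvesFrom S ((i , proj₁ e) ∷ K) (proj₂ e)) ch →
           SolvesFrom S K (node i ch)

SolvesAR : RuleSet → Tree → Set
SolvesAR S Γ = SolvesFrom S [] Γ

mutual
  depth : Tree → ℕ
  depth (leaf _)    = 0
  depth (node _ ch) = suc (depths ch)

  depths : List (ℕ × Tree) → ℕ
  depths []             = 0
  depths ((_ , t) ∷ ch) = depth t ⊔ depths ch

IsHAR : RuleSet → ℕ → Set
IsHAR S k =
  (∃ λ Γ → OTree S Γ × SolvesAR S Γ × (depth Γ ≡ k)) ×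
  (∀ Γ → OTree S Γ → SolvesAR S Γ → k ≤ depth Γ)

{-# OPTIONS --safe #-}
-- Take an o-tree Γ over S solving AR(S) and restrict it to S′.  A node labelled by an
-- attribute of S′ is kept with its edges whose labels lie in V_{S′}; a node labelled by
-- any other attribute a_i is replaced by its subtree along one value v_i ∈ V_S(a_i),
-- chosen once for all nodes; a leaf is relabelled by the rules of S′ whose conditions
-- lie on the new path.  This does not increase the depth.  Outside A(S′) the old path
-- only asserts a_i = v_i, so it is consistent whenever the new one is, and on A(S′)
-- the two paths agree: hence a rule of S′ that Γ accepts (rejects) at the old leaf is
-- accepted (rejected) at the new one.
module Submission where

open import Defs
open import Data.Empty using (⊥-elim)
open import Data.List using (List; []; _∷_; map; _++_; filter; concatMap)
open import Data.List.Membership.Propositional using (_∈_; find; lose)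
open import Data.List.Membership.Propositional.Properties
  using (∈-++⁺ˡ; ∈-++⁺ʳ; ∈-++⁻; ∈-filter⁺; ∈-filter⁻; ∈-concatMap⁺; ∈-concatMap⁻)
open import Data.List.Properties using (filter-accept; filter-reject)
open import Data.List.Relation.Unary.All as All using (All; []; _∷_; all?)
open import Data.List.Relation.Unary.Any using (Any; here; there; any?)
open import Data.List.Relation.Unary.Unique.Propositional using (Unique)
open import Data.List.Relation.Unary.Unique.Propositional.Properties using (filter⁺)
open import Data.Nat using (ℕ; _≤_; z≤n; s≤s; _≟_)
open import Data.Nat.Properties using (≤-trans; m≤m⊔n; m≤n⊔m; ⊔-mono-≤; m≤n⇒m≤1+n)
open import Data.Product using (∃; _×_; _,_; proj₁; proj₂)
open import Data.Product.Properties using (≡-dec)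
open import Data.Sum using (inj₁; inj₂)
open import Function.Bundles using (_⇔_; Equivalence; mk⇔)
open import Level using (0ℓ)
open import Relation.Binary.PropositionalEquality using (_≡_; refl; sym; trans; cong; subst)
open import Relation.Nullary using (¬_; Dec; yes; no)
open import Relation.Nullary.Decidable using (map′)
open import Relation.Unary using (Pred; Decidable)

_≟E_ : (e e′ : Equation) → Dec (e ≡ e′)
_≟E_ = ≡-dec _≟_ _≟_

open import Data.List.Membership.DecPropositional _≟E_ using (_∈?_)

_⊆E?_ : (K L : List Equation) → Dec (K ⊆E L)
K ⊆E? L = map′ (λ all e → All.lookup all) (λ sub → All.tabulate λ {e} → sub e) (all? (_∈? L) K)

inconsistent-++-transfer : ∀ {L K K′} → Consistent K →
  (∀ {j x y} → (j , x) ∈ K → (j , y) ∈ L → (j , x) ∈ K′) →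
  Inconsistent (L ++ K) → Inconsistent (L ++ K′)
inconsistent-++-transfer {L} cK transfer (j , x , y , x∈ , y∈ , x≢y) with ∈-++⁻ L x∈ | ∈-++⁻ L y∈
... | inj₁ x∈L | inj₁ y∈L = j , x , y , ∈-++⁺ˡ x∈L , ∈-++⁺ˡ y∈L , x≢y
... | inj₁ x∈L | inj₂ y∈K = j , x , y , ∈-++⁺ˡ x∈L , ∈-++⁺ʳ L (transfer y∈K x∈L) , x≢y
... | inj₂ x∈K | inj₁ y∈L = j , x , y , ∈-++⁺ʳ L (transfer x∈K y∈L) , ∈-++⁺ˡ y∈L , x≢y
... | inj₂ x∈K | inj₂ y∈K = ⊥-elim (cK (j , x , y , x∈K , y∈K , x≢y))

≈R-refl : ∀ r → r ≈R r
≈R-refl r = (λ _ → mk⇔ (λ c → c) (λ c → c)) , refl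

≈R-sym : ∀ {r r′} → r ≈R r′ → r′ ≈R r
≈R-sym (conds≈ , rhs≡) =
  (λ e → mk⇔ (Equivalence.from (conds≈ e)) (Equivalence.to (conds≈ e))) , sym rhs≡

RespectsR : Pred Rule 0ℓ → Set
RespectsR P = ∀ r r′ → r ≈R r′ → P r → P r′

Any⇒∈S : ∀ {P : Pred Rule 0ℓ} {S} → Any P S → ∃ λ r → r ∈S S × P r
Any⇒∈S anyP = let r , r∈ , Pr = find anyP in r , lose r∈ (≈R-refl r) , Pr

∈S⇒Any : ∀ {P : Pred Rule 0ℓ} {S} → RespectsR P → ∀ r → r ∈S S → P r → Any P S
∈S⇒Any resp r r∈S Pr = let r′ , r′∈ , r≈r′ = find r∈S in lose r′∈ (resp r r′ r≈r′ Pr)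

∈S-filter⁻ : ∀ {P : Pred Rule 0ℓ} (P? : Decidable P) {S} → RespectsR P → ∀ r →
             r ∈S filter P? S → r ∈S S × P r
∈S-filter⁻ P? {S} resp r r∈ =
  let r′ , r′∈ , r≈r′ = find r∈ ; r′∈S , Pr′ = ∈-filter⁻ P? {xs = S} r′∈
  in lose {P = r ≈R_} r′∈S r≈r′ , resp r′ r (≈R-sym {r} {r′} r≈r′) Pr′

∈S-filter⁺ : ∀ {P : Pred Rule 0ℓ} (P? : Decidable P) {S} → RespectsR P → ∀ r →
             r ∈S S → P r → r ∈S filter P? S
∈S-filter⁺ P? resp r r∈S Pr =
  let r′ , r′∈ , r≈r′ = find r∈S
  in lose {P = r ≈R_} (∈-filter⁺ P? r′∈ (resp r r′ r≈r′ Pr)) r≈r′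

conds-⊆E-respects : ∀ K → RespectsR (λ r → conds r ⊆E K)
conds-⊆E-respects K _ _ (conds≈ , _) sub e e∈ = sub e (Equivalence.from (conds≈ e) e∈)

∈-conds-respects : ∀ e → RespectsR (λ r → e ∈ conds r)
∈-conds-respects e _ _ (conds≈ , _) = Equivalence.to (conds≈ e)

InV-mono : ∀ {S S′ i δ} → S′ ⊆S S → InV S′ i δ → InV S i δ
InV-mono S′⊆S (r , r∈ , c) = r , S′⊆S r r∈ , c

InV? : ∀ S i δ → Dec (InV S i δ)
InV? S i δ = map′ Any⇒∈S (λ (r , r∈ , c) → ∈S⇒Any {P} (∈-conds-respects (i , δ)) r r∈ c)
                  (any? P? S)
  where
  P : Pred Rule 0ℓ
  P r = (i , δ) ∈ conds r
  P? : Decidable P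
  P? r = (i , δ) ∈? conds r

hasAttribute? : ∀ i (K : List Equation) → Dec (∃ λ δ → (i , δ) ∈ K)
hasAttribute? i K =
  map′ from (λ (_ , e∈) → lose {P = λ e → i ≡ proj₁ e} e∈ refl) (any? (λ e → i ≟ proj₁ e) K)
  where
  from : Any (λ e → i ≡ proj₁ e) K → ∃ λ δ → (i , δ) ∈ K
  from anyI with find anyI
  ... | (_ , δ) , e∈ , refl = δ , e∈

∈A? : ∀ S i → Dec (i ∈A S)
∈A? S i = map′ Any⇒∈S (λ (r , r∈ , δ , c) → ∈S⇒Any {P} resp r r∈ (δ , c))
               (any? (λ r → hasAttribute? i (conds r)) S)
  where
  P : Pred Rule 0ℓ
  P r = ∃ λ δ → (i , δ) ∈ conds r
  resp : RespectsR P
  resp r r′ r≈r′ (δ , c) = δ , ∈-conds-respects (i , δ) r r′ r≈r′ c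

valueOf : ℕ → List Equation → ℕ
valueOf i [] = 0
valueOf i ((j , δ) ∷ K) with i ≟ j
... | yes _ = δ
... | no _ = valueOf i K

valueOf-∈ : ∀ {i δ} K → (i , δ) ∈ K → (i , valueOf i K) ∈ K
valueOf-∈ {i} ((j , _) ∷ K) e∈ with i ≟ j
... | yes refl = here refl
valueOf-∈ ((j , _) ∷ K) (here refl) | no i≢j = ⊥-elim (i≢j refl)
valueOf-∈ ((j , _) ∷ K) (there e∈) | no _ = there (valueOf-∈ K e∈)

someValue : RuleSet → ℕ → ℕ
someValue S i = valueOf i (concatMap conds S)

someValue-InV : ∀ {S i δ} → InV S i δ → InV S i (someValue S i)
someValue-InV {S} {i} {δ} (r , r∈ , c) =
  Any⇒∈S (∈-concatMap⁻ conds (valueOf-∈ (concatMap conds S) (∈-concatMap⁺ conds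
    (∈S⇒Any {λ r → (i , δ) ∈ conds r} (∈-conds-respects (i , δ)) r r∈ c))))

subtreeAt : ℕ → List (ℕ × Tree) → Tree
subtreeAt v [] = leaf []
subtreeAt v ((δ , t) ∷ ch) with v ≟ δ
... | yes _ = t
... | no _ = subtreeAt v ch

subtreeAt-depth : ∀ v ch → depth (subtreeAt v ch) ≤ depths ch
subtreeAt-depth v [] = z≤n
subtreeAt-depth v ((δ , t) ∷ ch) with v ≟ δ
... | yes _ = m≤m⊔n (depth t) (depths ch)
... | no _ = ≤-trans (subtreeAt-depth v ch) (m≤n⊔m (depth t) (depths ch))

subtreeAt-All : ∀ {P : Pred Tree 0ℓ} {v} ch → v ∈ map proj₁ ch →
                All (λ e → proj₁ e ≡ v → P (proj₂ e)) ch → P (subtreeAt v ch)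
subtreeAt-All {v = v} ((δ , t) ∷ ch) v∈ (Pt ∷ Pch) with v ≟ δ
... | yes v≡δ = Pt (sym v≡δ)
... | no v≢δ with v∈
...   | here v≡δ = ⊥-elim (v≢δ v≡δ)
...   | there v∈ch = subtreeAt-All ch v∈ch Pch

module Restriction (S S′ : RuleSet) (S′⊆S : S′ ⊆S S) where

  coveredBy : List Equation → RuleSet
  coveredBy K = filter (λ r → conds r ⊆E? K) S′

  mutual
    restrict : List Equation → Tree → Tree
    restrict K (leaf _) = leaf (coveredBy K)
    restrict K (node i ch) with ∈A? S′ i
    ... | yes _ = node i (restrictEdges K i ch)
    -- restricting every child before choosing one keeps the recursion structural
    ... | no _ = subtreeAt (someValue S i) (restrictAll K ch)

    restrictEdges : List Equation → ℕ → List (ℕ × Tree) → List (ℕ × Tree)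
    restrictEdges K i [] = []
    restrictEdges K i ((δ , t) ∷ ch) with InV? S′ i δ
    ... | yes _ = (δ , restrict ((i , δ) ∷ K) t) ∷ restrictEdges K i ch
    ... | no _ = restrictEdges K i ch

    restrictAll : List Equation → List (ℕ × Tree) → List (ℕ × Tree)
    restrictAll K [] = []
    restrictAll K ((δ , t) ∷ ch) = (δ , restrict K t) ∷ restrictAll K ch

  restrictEdges-labels : ∀ K i ch →
                         map proj₁ (restrictEdges K i ch) ≡ filter (InV? S′ i) (map proj₁ ch)
  restrictEdges-labels K i [] = refl
  restrictEdges-labels K i ((δ , t) ∷ ch) with InV? S′ i δ
  ... | yes δ∈V = trans (cong (δ ∷_) (restrictEdges-labels K i ch))
                        (sym (filter-accept (InV? S′ i) δ∈V))
  ... | no δ∉V = trans (restrictEdges-labels K i ch) (sym (filter-reject (InV? S′ i) δ∉V))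

  restrictAll-labels : ∀ K ch → map proj₁ (restrictAll K ch) ≡ map proj₁ ch
  restrictAll-labels K [] = refl
  restrictAll-labels K ((δ , t) ∷ ch) = cong (δ ∷_) (restrictAll-labels K ch)

  restrictEdges-All : ∀ {P : ℕ → Tree → Set} K i ch →
    All (λ (δ , t) → InV S′ i δ → P δ (restrict ((i , δ) ∷ K) t)) ch →
    All (λ (δ , t) → P δ t) (restrictEdges K i ch)
  restrictEdges-All K i [] [] = []
  restrictEdges-All K i ((δ , t) ∷ ch) (Pt ∷ Pch) with InV? S′ i δ
  ... | yes δ∈V = Pt δ∈V ∷ restrictEdges-All K i ch Pch
  ... | no _ = restrictEdges-All K i ch Pch

  restrictAll-All : ∀ {P : ℕ → Tree → Set} K ch →
    All (λ (δ , t) → P δ (restrict K t)) ch → All (λ (δ , t) → P δ t) (restrictAll K ch)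
  restrictAll-All K [] [] = []
  restrictAll-All K ((δ , t) ∷ ch) (Pt ∷ Pch) = Pt ∷ restrictAll-All K ch Pch

  mutual
    restrict-depth : ∀ K Γ → depth (restrict K Γ) ≤ depth Γ
    restrict-depth K (leaf _) = z≤n
    restrict-depth K (node i ch) with ∈A? S′ i
    ... | yes _ = s≤s (restrictEdges-depth K i ch)
    ... | no _ = m≤n⇒m≤1+n (≤-trans (subtreeAt-depth (someValue S i) (restrictAll K ch))
                                   (restrictAll-depth K ch))

    restrictEdges-depth : ∀ K i ch → depths (restrictEdges K i ch) ≤ depths ch
    restrictEdges-depth K i [] = z≤n
    restrictEdges-depth K i ((δ , t) ∷ ch) with InV? S′ i δ
    ... | yes _ = ⊔-mono-≤ (restrict-depth ((i , δ) ∷ K) t) (restrictEdges-depth K i ch)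
    ... | no _ = ≤-trans (restrictEdges-depth K i ch) (m≤n⊔m (depth t) (depths ch))

    restrictAll-depth : ∀ K ch → depths (restrictAll K ch) ≤ depths ch
    restrictAll-depth K [] = z≤n
    restrictAll-depth K ((δ , t) ∷ ch) = ⊔-mono-≤ (restrict-depth K t) (restrictAll-depth K ch)

  restrictEdges-labels-exact : ∀ K i ch → (∀ δ → InV S′ i δ → δ ∈ map proj₁ ch) →
    ∀ δ → (δ ∈ map proj₁ (restrictEdges K i ch)) ⇔ InV S′ i δ
  restrictEdges-labels-exact K i ch V⊆labels δ rewrite restrictEdges-labels K i ch =
    mk⇔ (λ δ∈ → proj₂ (∈-filter⁻ (InV? S′ i) {xs = map proj₁ ch} δ∈))
        (λ δ∈V → ∈-filter⁺ (InV? S′ i) (V⊆labels δ δ∈V) δ∈V)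

  someValue-label : ∀ {i} K ch → i ∈A S → (∀ δ → (δ ∈ map proj₁ ch) ⇔ InV S i δ) →
                    someValue S i ∈ map proj₁ (restrictAll K ch)
  someValue-label K ch (r , r∈ , δ , c) labels≡V rewrite restrictAll-labels K ch =
    Equivalence.from (labels≡V _) (someValue-InV (r , r∈ , c))

  mutual
    restrict-OTree : ∀ K {Γ} → OTree S Γ → OTree S′ (restrict K Γ)
    restrict-OTree K (leaf-ok _) =
      leaf-ok (λ r r∈ → proj₁ (∈S-filter⁻ (λ r → conds r ⊆E? K) (conds-⊆E-respects K) r r∈))
    restrict-OTree K (node-ok {i} {ch} i∈A unique labels≡V subtrees) with ∈A? S′ i
    ... | yes i∈A′ =
      node-ok i∈A′
        (subst Unique (sym (restrictEdges-labels K i ch)) (filter⁺ (InV? S′ i) unique))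
        (restrictEdges-labels-exact K i ch
          (λ δ δ∈V → Equivalence.from (labels≡V δ) (InV-mono S′⊆S δ∈V)))
        (restrictEdges-All K i ch (All.map (λ o _ → o _) (restrictChildren-OTree ch subtrees)))
    ... | no _ =
      subtreeAt-All {OTree S′} (restrictAll K ch) (someValue-label K ch i∈A labels≡V)
        (restrictAll-All K ch (All.map (λ o _ → o K) (restrictChildren-OTree ch subtrees)))

    restrictChildren-OTree : ∀ (ch : List (ℕ × Tree)) → All (λ (_ , t) → OTree S t) ch →
                             All (λ (_ , t) → ∀ K → OTree S′ (restrict K t)) ch
    restrictChildren-OTree [] [] = []
    restrictChildren-OTree (_ ∷ ch) (o ∷ os) =
      (λ K → restrict-OTree K o) ∷ restrictChildren-OTree ch os

  -- K is a path prefix in Γ and K′ the corresponding path prefix in its restriction.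
  record Restricts (K K′ : List Equation) : Set where
    field
      kept      : ∀ {j x} → (j , x) ∈ K → j ∈A S′ → (j , x) ∈ K′
      defaulted : ∀ {j x} → (j , x) ∈ K → ¬ j ∈A S′ → x ≡ someValue S j
  open Restricts

  Restricts-[] : Restricts [] []
  Restricts-[] = record { kept = λ () ; defaulted = λ () }

  Restricts-keep : ∀ {K K′ i δ} → i ∈A S′ → Restricts K K′ → Restricts ((i , δ) ∷ K) ((i , δ) ∷ K′)
  kept (Restricts-keep _ R) (here refl) _ = here refl
  kept (Restricts-keep _ R) (there e∈) j∈A = there (kept R e∈ j∈A)
  defaulted (Restricts-keep i∈A _) (here refl) i∉A = ⊥-elim (i∉A i∈A)
  defaulted (Restricts-keep _ R) (there e∈) = defaulted R e∈

  Restricts-skip : ∀ {K K′ i δ} → ¬ i ∈A S′ → δ ≡ someValue S i → Restricts K K′ →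
                   Restricts ((i , δ) ∷ K) K′
  kept (Restricts-skip i∉A _ _) (here refl) i∈A = ⊥-elim (i∉A i∈A)
  kept (Restricts-skip _ _ R) (there e∈) = kept R e∈
  defaulted (Restricts-skip _ δ≡v _) (here refl) _ = δ≡v
  defaulted (Restricts-skip _ _ R) (there e∈) = defaulted R e∈

  Restricts-consistent : ∀ {K K′} → Restricts K K′ → Consistent K′ → Consistent K
  Restricts-consistent R cK′ (j , x , y , x∈ , y∈ , x≢y) with ∈A? S′ j
  ... | yes j∈A = cK′ (j , x , y , kept R x∈ j∈A , kept R y∈ j∈A , x≢y)
  ... | no j∉A = x≢y (trans (defaulted R x∈ j∉A) (sym (defaulted R y∈ j∉A)))

  restrict-leaf : ∀ {K K′ τ} → Restricts K K′ → SolvesFrom S K (leaf τ) →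
                  SolvesFrom S′ K′ (leaf (coveredBy K′))
  restrict-leaf {K} {K′} {τ} R (leaf-s solvesτ) =
    leaf-s λ cK′ → covered⊆ , uncovered-inconsistent cK′
    where
    covered? : Decidable (λ r → conds r ⊆E K′)
    covered? r = conds r ⊆E? K′

    covered⊆ : ∀ r → r ∈S coveredBy K′ → conds r ⊆E K′
    covered⊆ r r∈ = proj₂ (∈S-filter⁻ covered? {S′} (conds-⊆E-respects K′) r r∈)

    uncovered-inconsistent : Consistent K′ → ∀ r → r ∈S S′ → ¬ r ∈S coveredBy K′ →
                             Inconsistent (conds r ++ K′)
    uncovered-inconsistent cK′ r r∈S′ r∉covered =
      inconsistent-++-transfer cK (λ e∈K c → kept R e∈K (r , r∈S′ , _ , c))
        (proj₂ (solvesτ cK) r (S′⊆S r r∈S′) r∉τ)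
      where
      cK : Consistent K
      cK = Restricts-consistent R cK′
      r∉τ : ¬ r ∈S τ
      r∉τ r∈τ = r∉covered (∈S-filter⁺ covered? (conds-⊆E-respects K′) r r∈S′
        (λ e c → kept R (proj₁ (solvesτ cK) r r∈τ e c) (r , r∈S′ , _ , c)))

  mutual
    restrict-solves : ∀ {K K′ Γ} → OTree S Γ → SolvesFrom S K Γ → Restricts K K′ →
                      SolvesFrom S′ K′ (restrict K′ Γ)
    restrict-solves (leaf-ok _) solves R = restrict-leaf R solves
    restrict-solves {K′ = K′} (node-ok {i} {ch} i∈A _ labels≡V subtrees) (node-s solves) R
      with ∈A? S′ i
    ... | yes i∈A′ =
      node-s (restrictEdges-All K′ i ch
        (All.map (λ s _ → s (Restricts-keep i∈A′ R)) (restrictChildren-solves ch subtrees solves)))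
    ... | no i∉A′ =
      subtreeAt-All {SolvesFrom S′ K′} (restrictAll K′ ch) (someValue-label K′ ch i∈A labels≡V)
        (restrictAll-All K′ ch
          (All.map (λ s δ≡v → s (Restricts-skip i∉A′ δ≡v R))
                   (restrictChildren-solves ch subtrees solves)))

    restrictChildren-solves : ∀ {K : List Equation} {i : ℕ} (ch : List (ℕ × Tree)) →
      All (λ (_ , t) → OTree S t) ch →
      All (λ (δ , t) → SolvesFrom S ((i , δ) ∷ K) t) ch →
      All (λ (δ , t) → ∀ {K′} → Restricts ((i , δ) ∷ K) K′ → SolvesFrom S′ K′ (restrict K′ t)) ch
    restrictChildren-solves [] [] [] = []
    restrictChildren-solves {K} {i} (_ ∷ ch) (o ∷ os) (s ∷ ss) =
      (λ {K′} → restrict-solves {K′ = K′} o s) ∷ restrictChildren-solves {K} {i} ch os ss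

lemma18 : (S S' : RuleSet) → NonEmpty S → NonEmpty S' → S' ⊆S S →
    (k k' : ℕ) → IsHAR S k → IsHAR S' k' → k' ≤ k
lemma18 S S' _ _ S'⊆S _ k' ((Γ , Γ-tree , Γ-solves , refl) , _) (_ , k'-minimal) =
  ≤-trans (k'-minimal Γ′ (restrict-OTree [] Γ-tree) (restrict-solves Γ-tree Γ-solves Restricts-[]))
          (restrict-depth [] Γ)
  where
  open Restriction S S' S'⊆S
  Γ′ : Tree
  Γ′ = restrict [] Γ
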